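{- Every instance (for arbitrary formulae $\varphi,\psi$ and program variables $x,y$) of each of the following schemata is derivable in $\mathsf{C}(\ast)$: (i) $(x\sim y\wedge(\varphi\ast\psi))\Rightarrow((\varphi\wedge x\sim y)\ast\psi)$, where $x\sim y$ stands for $x=y$ or for $\neg(x=y)$; (ii) $(x=y\wedge((\varphi\wedge\mathrm{alloc}(x))\ast\psi))\Rightarrow((\varphi\wedge\mathrm{alloc}(y))\ast\psi)$; (iii) $((\varphi\wedge\mathrm{alloc}(x))\ast\psi)\Rightarrow(\varphi\ast(\psi\wedge\neg\mathrm{alloc}(x)))$; (iv) $(\neg\mathrm{alloc}(x)\wedge(\varphi\ast\psi))\Rightarrow((\varphi\wedge\neg\mathrm{alloc}(x))\ast\psi)$; (v) $(\mathrm{alloc}(x)\wedge(\varphi\ast(\neg\mathrm{alloc}(x)\wedge\psi)))\Rightarrow((\varphi\wedge\mathrm{alloc}(x))\ast(\neg\mathrm{alloc}(x)\wedge\psi))$; (vi) $(x\hookrightarrow y\wedge((\varphi\wedge\mathrm{alloc}(x))\ast\psi))\Rightarrow((\varphi\wedge x\hookrightarrow y)\ast\psi)$; (vii) $(\neg x\hookrightarrow y\wedge(\varphi\ast\psi))\Rightarrow((\varphi\wedge\neg x\hookrightarrow y)\ast\psi)$.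
   Context: Logic $\mathrm{SL}(\ast,\mathrm{alloc})$: fix a countably infinite set $\mathrm{PVAR}$ of program variables. Formulae: $\varphi ::= x = y \mid x \hookrightarrow y \mid \mathrm{emp}\mid \mathrm{alloc}(x) \mid \neg\varphi \mid \varphi\wedge\varphi \mid \varphi \ast \varphi$ ($x,y\in\mathrm{PVAR}$); $\vee,\Rightarrow,\Leftrightarrow$ usual abbreviations. Abbreviations: $\bot:=\neg(x=x)$, $\top:=\neg\bot$, $\mathrm{size}\ge0:=\top$, $\mathrm{size}\ge1:=\neg\mathrm{emp}$, $\mathrm{size}\ge\beta:=\neg\mathrm{emp}\ast\mathrm{size}\ge\beta-1$ for $\beta\ge2$; $\mathrm{size}=\beta:=\mathrm{size}\ge\beta\wedge\neg\,\mathrm{size}\ge\beta+1$; $a\dot-b=\max(0,a-b)$. The proof system $\mathsf{C}(\ast)$ (derivability is the least set of formulae containing all instances of the axiom schemata, metavariables ranging over formulae, variables, naturals and finite sets of variables, and closed under the rules) consists of all axiom schemata of classical propositional calculus, modus ponens, and: (1) $x=x$; (2) $\varphi\wedge x=y\Rightarrow\varphi'$, where $\varphi'$ is obtained from $\varphi$ by replacing every occurrence of $y$ with $x$; (3) $x\hookrightarrow y\Rightarrow\mathrm{alloc}(x)$; (4) $(x\hookrightarrow y\wedge x\hookrightarrow z)\Rightarrow y=z$; (5) $\mathrm{size}\ge\beta+1\Rightarrow\mathrm{size}\ge\beta$; (6) $\bigwedge_{x\in X}(\mathrm{alloc}(x)\wedge\bigwedge_{y\in X\setminus\{x\}}\neg(x=y))\Rightarrow\mathrm{size}\ge|X|$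 for finite $X$; (7) $(\varphi\ast\psi)\Leftrightarrow(\psi\ast\varphi)$; (8) $((\varphi\ast\psi)\ast\chi)\Leftrightarrow(\varphi\ast(\psi\ast\chi))$; (9) $((\varphi\vee\psi)\ast\chi)\Rightarrow((\varphi\ast\chi)\vee(\psi\ast\chi))$; (10) $(\bot\ast\varphi)\Leftrightarrow\bot$; (11) $\varphi\Leftrightarrow(\varphi\ast\mathrm{emp})$; (12) $(\mathrm{alloc}(x)\ast\top)\Rightarrow\mathrm{alloc}(x)$; (13) $(\mathrm{alloc}(x)\ast\mathrm{alloc}(x))\Leftrightarrow\bot$; (14) $(\xi\ast\top)\Rightarrow\xi$ for $\xi\in\{\neg\mathrm{emp},\ x=y,\ \neg(x=y),\ x\hookrightarrow y\}$; (15) $(\neg\mathrm{alloc}(x)\ast\neg\mathrm{alloc}(x))\Rightarrow\neg\mathrm{alloc}(x)$; (16) $((\mathrm{alloc}(x)\wedge\neg x\hookrightarrow y)\ast\top)\Rightarrow\neg x\hookrightarrow y$; (17) $\mathrm{alloc}(x)\Rightarrow((\mathrm{alloc}(x)\wedge\mathrm{size}=1)\ast\top)$; (18) $\neg\mathrm{emp}\Rightarrow(\mathrm{size}=1\ast\top)$; (19) $(\neg\,\mathrm{size}\ge\beta_1\ast\neg\,\mathrm{size}\ge\beta_2)\Rightarrow\neg\,\mathrm{size}\ge\beta_1+\beta_2\dot-1$; (20) $(\mathrm{alloc}(x)\wedge\mathrm{alloc}(y)\wedge\neg(x=y))\Rightarrow\mathrm{size}\ge2$; and the rule: from $\varphi\Rightarrow\chi$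 infer $(\varphi\ast\psi)\Rightarrow(\chi\ast\psi)$. -}

module Defs where

open import Data.Nat using (ℕ; zero; suc; _+_; _∸_; _≟_)
open import Data.Bool using (Bool; true; false; not; _∧_; if_then_else_)
open import Data.List using (List; []; _∷_; length; filter)
open import Data.List.Relation.Unary.Unique.Propositional using (Unique)
open import Relation.Binary.PropositionalEquality using (_≡_)
open import Relation.Nullary.Decidable using (⌊_⌋)

PVAR : Set
PVAR = ℕ

data Form : Set where
  _≐_    : PVAR → PVAR → Form
  _↪_    : PVAR → PVAR → Form
  emp    : Form
  alloc  : PVAR → Form
  ¬'_    : Form → Form
  _∧'_   : Form → Form → Form
  _∗_    : Form → Form → Form

infixr 6 _∧'_
infixr 5 _∨'_
infixr 4 _⇒_ _⇔_
infixr 7 _∗_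
infix 9 ¬'_

_∨'_ : Form → Form → Form
φ ∨' ψ = ¬' (¬' φ ∧' ¬' ψ)

_⇒_ : Form → Form → Form
φ ⇒ ψ = ¬' (φ ∧' ¬' ψ)

_⇔_ : Form → Form → Form
φ ⇔ ψ = (φ ⇒ ψ) ∧' (ψ ⇒ φ)

⊥' : Form
⊥' = ¬' (0 ≐ 0)

⊤' : Form
⊤' = ¬' ⊥'

size≥ : ℕ → Form
size≥ zero = ⊤'
size≥ (suc zero) = ¬' emp
size≥ (suc (suc β)) = ¬' emp ∗ size≥ (suc β)

size≡ : ℕ → Form
size≡ β = size≥ β ∧' ¬' size≥ (suc β)

varSub : PVAR → PVAR → PVAR → PVAR
varSub x y z = if ⌊ z ≟ y ⌋ then x else z

subst[_/_] : PVAR → PVAR → Form → Form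
subst[ x / y ] (a ≐ b) = varSub x y a ≐ varSub x y b
subst[ x / y ] (a ↪ b) = varSub x y a ↪ varSub x y b
subst[ x / y ] emp = emp
subst[ x / y ] (alloc a) = alloc (varSub x y a)
subst[ x / y ] (¬' φ) = ¬' subst[ x / y ] φ
subst[ x / y ] (φ ∧' ψ) = subst[ x / y ] φ ∧' subst[ x / y ] ψ
subst[ x / y ] (φ ∗ ψ) = subst[ x / y ] φ ∗ subst[ x / y ] ψ

⋀ : List Form → Form
⋀ [] = ⊤'
⋀ (φ ∷ φs) = φ ∧' ⋀ φs

mapL : {A B : Set} → (A → B) → List A → List B
mapL f [] = []
mapL f (a ∷ as) = f a ∷ mapL f as

remove : PVAR → List PVAR → List PVAR
remove x [] = []
remove x (z ∷ zs) = if ⌊ z ≟ x ⌋ then remove x zs else z ∷ remove x zs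

-- premise of axiom (6) for a finite set X (given as a duplicate-free list)
distinctAlloc : List PVAR → Form
distinctAlloc X =
  ⋀ (mapL (λ x → alloc x ∧' ⋀ (mapL (λ y → ¬' (x ≐ y)) (remove x X))) X)

-- Classical propositional calculus: all substitution instances of
-- propositional tautologies (in the connectives ¬, ∧).

data PForm : Set where
  pv   : ℕ → PForm
  p¬   : PForm → PForm
  _p∧_ : PForm → PForm → PForm

evalP : (ℕ → Bool) → PForm → Bool
evalP v (pv n) = v n
evalP v (p¬ p) = not (evalP v p)
evalP v (p p∧ q) = evalP v p ∧ evalP v q

Tautology : PForm → Set
Tautology p = (v : ℕ → Bool) → evalP v p ≡ true

instP : (ℕ → Form) → PForm → Form
instP σ (pv n) = σ n
instP σ (p¬ p) = ¬' instP σ p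
instP σ (p p∧ q) = instP σ p ∧' instP σ q

data ⊢_ : Form → Set where
  taut  : (p : PForm) → Tautology p → (σ : ℕ → Form) → ⊢ instP σ p
  mp    : {φ ψ : Form} → ⊢ (φ ⇒ ψ) → ⊢ φ → ⊢ ψ
  ax1   : (x : PVAR) → ⊢ (x ≐ x)
  ax2   : (φ : Form) (x y : PVAR) → ⊢ (φ ∧' (x ≐ y) ⇒ subst[ x / y ] φ)
  ax3   : (x y : PVAR) → ⊢ ((x ↪ y) ⇒ alloc x)
  ax4   : (x y z : PVAR) → ⊢ ((x ↪ y) ∧' (x ↪ z) ⇒ (y ≐ z))
  ax5   : (β : ℕ) → ⊢ (size≥ (suc β) ⇒ size≥ β)
  ax6   : (X : List PVAR) → Unique X → ⊢ (distinctAlloc X ⇒ size≥ (length X))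
  ax7   : (φ ψ : Form) → ⊢ ((φ ∗ ψ) ⇔ (ψ ∗ φ))
  ax8   : (φ ψ χ : Form) → ⊢ (((φ ∗ ψ) ∗ χ) ⇔ (φ ∗ (ψ ∗ χ)))
  ax9   : (φ ψ χ : Form) → ⊢ (((φ ∨' ψ) ∗ χ) ⇒ ((φ ∗ χ) ∨' (ψ ∗ χ)))
  ax10  : (φ : Form) → ⊢ ((⊥' ∗ φ) ⇔ ⊥')
  ax11  : (φ : Form) → ⊢ (φ ⇔ (φ ∗ emp))
  ax12  : (x : PVAR) → ⊢ ((alloc x ∗ ⊤') ⇒ alloc x)
  ax13  : (x : PVAR) → ⊢ ((alloc x ∗ alloc x) ⇔ ⊥')
  ax14a : ⊢ ((¬' emp ∗ ⊤') ⇒ ¬' emp)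
  ax14b : (x y : PVAR) → ⊢ (((x ≐ y) ∗ ⊤') ⇒ (x ≐ y))
  ax14c : (x y : PVAR) → ⊢ ((¬' (x ≐ y) ∗ ⊤') ⇒ ¬' (x ≐ y))
  ax14d : (x y : PVAR) → ⊢ (((x ↪ y) ∗ ⊤') ⇒ (x ↪ y))
  ax15  : (x : PVAR) → ⊢ ((¬' alloc x ∗ ¬' alloc x) ⇒ ¬' alloc x)
  ax16  : (x y : PVAR) → ⊢ (((alloc x ∧' ¬' (x ↪ y)) ∗ ⊤') ⇒ ¬' (x ↪ y))
  ax17  : (x : PVAR) → ⊢ (alloc x ⇒ ((alloc x ∧' size≡ 1) ∗ ⊤'))
  ax18  : ⊢ (¬' emp ⇒ (size≡ 1 ∗ ⊤'))
  ax19  : (β₁ β₂ : ℕ) →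
          ⊢ ((¬' size≥ β₁ ∗ ¬' size≥ β₂) ⇒ ¬' size≥ ((β₁ + β₂) ∸ 1))
  ax20  : (x y : PVAR) → ⊢ (alloc x ∧' alloc y ∧' ¬' (x ≐ y) ⇒ size≥ 2)
  ∗-intro : {φ χ : Form} (ψ : Form) → ⊢ (φ ⇒ χ) → ⊢ ((φ ∗ ψ) ⇒ (χ ∗ ψ))

-- Every schema is an instance of one refinement principle: to replace
-- φ ∗ ψ by (φ ∧ ξ) ∗ ψ, split φ into φ ∧ ξ and φ ∧ ¬ξ (axiom 9) and show
-- that the case (φ ∧ ¬ξ) ∗ ψ contradicts the available hypothesis θ
-- (`∗-refineˡ`).  The contradiction comes from one of three sources:
--   * ¬ξ is monotone, (¬ξ ∗ ⊤) ⇒ ¬ξ, contradicting θ = ξ itself; this gives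
--     (i), (iv), (vii) via axioms 12 and 14 (`import-pure`);
--   * two disjoint copies of alloc(x) are inconsistent (axiom 13), giving (iii);
--   * the axioms 15 and 16 about ¬alloc(x) and alloc(x) ∧ ¬ x ↪ y, giving
--     (v) and (vi).
-- Schema (ii) follows from (i) and the congruence alloc(x) ∧ x = y ⇒ alloc(y)
-- (axiom 2).
module Submission where

open import Defs
open import Data.Bool using (Bool; true; false; not; _∧_; T; if_then_else_)
open import Data.Bool.Properties using (T-∧; T-≡)
open import Data.List using (List; []; _∷_)
open import Data.Nat using (ℕ; zero; suc)
open import Data.Nat.Properties using (≟-diag)
open import Data.Product using (_×_; _,_; proj₁; proj₂)
open import Function.Bundles using (Equivalence)
open import Relation.Binary.PropositionalEquality using (_≡_; refl; cong; cong₂; subst; trans)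
open import Relation.Nullary.Decidable using (⌊_⌋)

open Equivalence using (to)

variable
  φ ψ χ θ ξ φ′ ψ′ : Form
  x y : PVAR

-- Propositional schemata over four metavariables; `_⟹_` and `_∨_` unfold
-- exactly as `_⇒_` and `_∨'_` do in Defs, so instances match syntactically.
data Schema : Set where
  A B C D : Schema
  ~_      : Schema → Schema
  _&_     : Schema → Schema → Schema

infix  9 ~_
infixr 6 _&_
infixr 5 _∨_
infixr 4 _⟹_

_⟹_ : Schema → Schema → Schema
p ⟹ q = ~ (p & ~ q)

_∨_ : Schema → Schema → Schema
p ∨ q = ~ (~ p & ~ q)

embed : Schema → PForm
embed A       = pv 0
embed B       = pv 1
embed C       = pv 2
embed D       = pv 3
embed (~ p)   = p¬ (embed p)
embed (p & q) = embed p p∧ embed q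

⟦_⟧ : Schema → Bool → Bool → Bool → Bool → Bool
⟦ A ⟧     a b c d = a
⟦ B ⟧     a b c d = b
⟦ C ⟧     a b c d = c
⟦ D ⟧     a b c d = d
⟦ ~ p ⟧   a b c d = not (⟦ p ⟧ a b c d)
⟦ p & q ⟧ a b c d = ⟦ p ⟧ a b c d ∧ ⟦ q ⟧ a b c d

embed-eval : (v : ℕ → Bool) (p : Schema) →
             evalP v (embed p) ≡ ⟦ p ⟧ (v 0) (v 1) (v 2) (v 3)
embed-eval v A       = refl
embed-eval v B       = refl
embed-eval v C       = refl
embed-eval v D       = refl
embed-eval v (~ p)   = cong not (embed-eval v p)
embed-eval v (p & q) = cong₂ _∧_ (embed-eval v p) (embed-eval v q)

every : (Bool → Bool) → Bool
every f = f true ∧ f false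

every-sound : (f : Bool → Bool) → T (every f) → (b : Bool) → T (f b)
every-sound f h true  = proj₁ (to T-∧ h)
every-sound f h false = proj₂ (to T-∧ h)

valid : Schema → Bool
valid p = every λ a → every λ b → every λ c → every λ d → ⟦ p ⟧ a b c d

valid-sound : (p : Schema) → T (valid p) → (a b c d : Bool) → T (⟦ p ⟧ a b c d)
valid-sound p h a b c d =
  every-sound (⟦ p ⟧ a b c) (every-sound (λ c → every (⟦ p ⟧ a b c))
    (every-sound (λ b → every λ c → every (⟦ p ⟧ a b c))
      (every-sound (λ a → every λ b → every λ c → every (⟦ p ⟧ a b c)) h a) b) c) d

valid-tautology : (p : Schema) → T (valid p) → Tautology (embed p)
valid-tautology p h v =
  trans (embed-eval v p) (to T-≡ (valid-sound p h (v 0) (v 1) (v 2) (v 3)))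

_!_ : List Form → ℕ → Form
[]      ! n     = ⊤'
(α ∷ σ) ! zero  = α
(α ∷ σ) ! suc n = σ ! n

tautology : (p : Schema) {_ : T (valid p)} (σ : List Form) → ⊢ instP (σ !_) (embed p)
tautology p {h} σ = taut (embed p) (valid-tautology p h) (σ !_)

⇒-trans : ⊢ (φ ⇒ ψ) → ⊢ (ψ ⇒ χ) → ⊢ (φ ⇒ χ)
⇒-trans {φ} {ψ} {χ} p q =
  mp (mp (tautology ((A ⟹ B) ⟹ (B ⟹ C) ⟹ (A ⟹ C)) (φ ∷ ψ ∷ χ ∷ [])) p) q

∧-elim : ⊢ (φ ∧' ψ) → ⊢ φ
∧-elim {φ} {ψ} = mp (tautology (A & B ⟹ A) (φ ∷ ψ ∷ []))

⊤-intro : ⊢ ⊤'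
⊤-intro = mp (tautology (A ⟹ ~ ~ A) (0 ≐ 0 ∷ [])) (ax1 0)

⇒-⊤ : ⊢ (φ ⇒ ⊤')
⇒-⊤ {φ} = mp (tautology (A ⟹ B ⟹ A) (⊤' ∷ φ ∷ [])) ⊤-intro

∧-projˡ : ⊢ (φ ∧' ψ ⇒ φ)
∧-projˡ {φ} {ψ} = tautology (A & B ⟹ A) (φ ∷ ψ ∷ [])

∧-projʳ : ⊢ (φ ∧' ψ ⇒ ψ)
∧-projʳ {φ} {ψ} = tautology (A & B ⟹ B) (φ ∷ ψ ∷ [])

∗-comm : ⊢ ((φ ∗ ψ) ⇒ (ψ ∗ φ))
∗-comm {φ} {ψ} = ∧-elim (ax7 φ ψ)

∗-monoˡ : ⊢ (φ ⇒ φ′) → ⊢ ((φ ∗ ψ) ⇒ (φ′ ∗ ψ))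
∗-monoˡ {ψ = ψ} = ∗-intro ψ

∗-monoʳ : ⊢ (ψ ⇒ ψ′) → ⊢ ((φ ∗ ψ) ⇒ (φ ∗ ψ′))
∗-monoʳ p = ⇒-trans ∗-comm (⇒-trans (∗-monoˡ p) ∗-comm)

∗-mono : ⊢ (φ ⇒ φ′) → ⊢ (ψ ⇒ ψ′) → ⊢ ((φ ∗ ψ) ⇒ (φ′ ∗ ψ′))
∗-mono p q = ⇒-trans (∗-monoˡ p) (∗-monoʳ q)

∗-cases : (ξ : Form) → ⊢ ((φ ∗ ψ) ⇒ (((φ ∧' ξ) ∗ ψ) ∨' ((φ ∧' ¬' ξ) ∗ ψ)))
∗-cases {φ} {ψ} ξ =
  ⇒-trans (∗-monoˡ (tautology (A ⟹ (A & B) ∨ (A & ~ B)) (φ ∷ ξ ∷ [])))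
          (ax9 (φ ∧' ξ) (φ ∧' ¬' ξ) ψ)

∗-refineˡ : ⊢ (((φ ∧' ¬' ξ) ∗ ψ) ⇒ ¬' θ) → ⊢ (θ ∧' (φ ∗ ψ) ⇒ ((φ ∧' ξ) ∗ ψ))
∗-refineˡ {φ} {ξ} {ψ} {θ} refute =
  mp (mp (tautology ((A ⟹ B ∨ C) ⟹ (C ⟹ ~ D) ⟹ (D & A ⟹ B))
                    (φ ∗ ψ ∷ (φ ∧' ξ) ∗ ψ ∷ (φ ∧' ¬' ξ) ∗ ψ ∷ θ ∷ []))
         (∗-cases ξ))
     refute

-- Unconditional refinement, when the ¬ξ-case is inconsistent outright
-- (the refinement principle with the axiom θ = (0 = 0), whose negation is ⊥).
∗-refineˡ-absurd : ⊢ (((φ ∧' ¬' ξ) ∗ ψ) ⇒ ⊥') → ⊢ ((φ ∗ ψ) ⇒ ((φ ∧' ξ) ∗ ψ))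
∗-refineˡ-absurd {φ} {ξ} {ψ} refute =
  mp (mp (tautology (A ⟹ (A & B ⟹ C) ⟹ (B ⟹ C))
                    (0 ≐ 0 ∷ φ ∗ ψ ∷ (φ ∧' ξ) ∗ ψ ∷ []))
         (ax1 0))
     (∗-refineˡ refute)

Monotone : Form → Set
Monotone χ = ⊢ ((χ ∗ ⊤') ⇒ χ)

-- Monotonicity is preserved by double negation (needed because the
-- axioms give monotonicity of ξ where the refinement needs it for ¬¬ξ).
monotone-¬¬ : Monotone χ → Monotone (¬' ¬' χ)
monotone-¬¬ {χ} mono =
  ⇒-trans (∗-monoˡ (tautology (~ ~ A ⟹ A) (χ ∷ [])))
          (⇒-trans mono (tautology (A ⟹ ~ ~ A) (χ ∷ [])))

-- A formula whose negation is monotone can be imported into the left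
-- component: a ¬ξ-subheap would make ¬ξ true of the whole heap.
import-pure : Monotone (¬' ξ) → ⊢ (ξ ∧' (φ ∗ ψ) ⇒ ((φ ∧' ξ) ∗ ψ))
import-pure mono = ∗-refineˡ (⇒-trans (∗-mono ∧-projʳ ⇒-⊤) mono)

-- Allocation respects equality of variables (axiom 2, contraposed).
varSub-self : (x y : PVAR) → varSub x y y ≡ x
varSub-self x y = cong (λ d → if ⌊ d ⌋ then x else y) (≟-diag {y} refl)

alloc-cong : ⊢ (alloc x ∧' (x ≐ y) ⇒ alloc y)
alloc-cong {x} {y} =
  mp (tautology ((~ A & B ⟹ ~ C) ⟹ (C & B ⟹ A)) (alloc y ∷ x ≐ y ∷ alloc x ∷ []))
     (subst (λ z → ⊢ (¬' alloc y ∧' (x ≐ y) ⇒ ¬' alloc z))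
            (varSub-self x y) (ax2 (¬' alloc y) x y))

equal-import : ⊢ ((x ≐ y) ∧' (φ ∗ ψ) ⇒ ((φ ∧' (x ≐ y)) ∗ ψ))
equal-import {x} {y} = import-pure (ax14c x y)

unequal-import : ⊢ (¬' (x ≐ y) ∧' (φ ∗ ψ) ⇒ ((φ ∧' ¬' (x ≐ y)) ∗ ψ))
unequal-import {x} {y} = import-pure (monotone-¬¬ (ax14b x y))

alloc-rename : ⊢ ((x ≐ y) ∧' ((φ ∧' alloc x) ∗ ψ) ⇒ ((φ ∧' alloc y) ∗ ψ))
alloc-rename {x} {y} {φ} =
  ⇒-trans equal-import
          (∗-monoˡ (mp (tautology ((A & B ⟹ C) ⟹ ((D & A) & B ⟹ D & C))
                                  (alloc x ∷ x ≐ y ∷ alloc y ∷ φ ∷ []))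
                       alloc-cong))

-- (iii): a cell allocated on the left is not allocated on the right,
-- since alloc(x) ∗ alloc(x) is inconsistent (axiom 13).
alloc-export : ⊢ (((φ ∧' alloc x) ∗ ψ) ⇒ (φ ∗ (ψ ∧' ¬' alloc x)))
alloc-export {φ} {x} {ψ} =
  ⇒-trans ∗-comm
  (⇒-trans (∗-refineˡ-absurd
             (⇒-trans (∗-mono (tautology (A & ~ ~ B ⟹ B) (ψ ∷ alloc x ∷ [])) ∧-projʳ)
                      (∧-elim (ax13 x))))
  (⇒-trans ∗-comm (∗-monoˡ ∧-projˡ)))

-- (iv): ¬alloc(x) is imported because alloc(x) is monotone (axiom 12).
unalloc-import : ⊢ (¬' alloc x ∧' (φ ∗ ψ) ⇒ ((φ ∧' ¬' alloc x) ∗ ψ))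
unalloc-import {x} = import-pure (monotone-¬¬ (ax12 x))

-- (v): if x is unallocated on the right it is allocated on the left,
-- since ¬alloc(x) ∗ ¬alloc(x) implies ¬alloc(x) (axiom 15).
alloc-import : ⊢ (alloc x ∧' (φ ∗ (¬' alloc x ∧' ψ)) ⇒ ((φ ∧' alloc x) ∗ (¬' alloc x ∧' ψ)))
alloc-import {x} = ∗-refineˡ (⇒-trans (∗-mono ∧-projʳ ∧-projˡ) (ax15 x))

-- (vi): the points-to fact follows the cell allocated on the left (axiom 16).
pointsTo-import : ⊢ ((x ↪ y) ∧' ((φ ∧' alloc x) ∗ ψ) ⇒ ((φ ∧' (x ↪ y)) ∗ ψ))
pointsTo-import {x} {y} {φ} =
  ⇒-trans (∗-refineˡ
            (⇒-trans (∗-mono (tautology ((A & B) & C ⟹ B & C) (φ ∷ alloc x ∷ ¬' (x ↪ y) ∷ [])) ⇒-⊤)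
                     (ax16 x y)))
          (∗-monoˡ (tautology ((A & B) & C ⟹ A & C) (φ ∷ alloc x ∷ x ↪ y ∷ [])))

-- (vii): ¬ x ↪ y is imported because x ↪ y is monotone (axiom 14).
nonPointsTo-import : ⊢ (¬' (x ↪ y) ∧' (φ ∗ ψ) ⇒ ((φ ∧' ¬' (x ↪ y)) ∗ ψ))
nonPointsTo-import {x} {y} = import-pure (monotone-¬¬ (ax14d x y))

lemma5p2 : (φ ψ : Form) (x y : PVAR) →
      (⊢ ((x ≐ y) ∧' (φ ∗ ψ) ⇒ ((φ ∧' (x ≐ y)) ∗ ψ)))
    × (⊢ (¬' (x ≐ y) ∧' (φ ∗ ψ) ⇒ ((φ ∧' ¬' (x ≐ y)) ∗ ψ)))
    × (⊢ ((x ≐ y) ∧' ((φ ∧' alloc x) ∗ ψ) ⇒ ((φ ∧' alloc y) ∗ ψ)))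
    × (⊢ (((φ ∧' alloc x) ∗ ψ) ⇒ (φ ∗ (ψ ∧' ¬' alloc x))))
    × (⊢ (¬' alloc x ∧' (φ ∗ ψ) ⇒ ((φ ∧' ¬' alloc x) ∗ ψ)))
    × (⊢ (alloc x ∧' (φ ∗ (¬' alloc x ∧' ψ)) ⇒ ((φ ∧' alloc x) ∗ (¬' alloc x ∧' ψ))))
    × (⊢ ((x ↪ y) ∧' ((φ ∧' alloc x) ∗ ψ) ⇒ ((φ ∧' (x ↪ y)) ∗ ψ)))
    × (⊢ (¬' (x ↪ y) ∧' (φ ∗ ψ) ⇒ ((φ ∧' ¬' (x ↪ y)) ∗ ψ)))
lemma5p2 φ ψ x y =
    equal-import
  , unequal-import
  , alloc-rename
  , alloc-export
  , unalloc-import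
  , alloc-import
  , pointsTo-import
  , nonPointsTo-import
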